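{- If the sequent $\cdot;\cdot\Rightarrow\bot$ has a cut-free derivation in $NL^{\Rightarrow}$, then it has one using only nonlogical rules, in which each sequent is of the form $\cdot;\Gamma\Rightarrow\bot$ where $\Gamma$ is a constraint set (a set of atomic formulas each of which is an equality $t\approx u$ or a freshness formula $a\mathrel{\#}t$).
   Context: Syntax. Types $\tau ::= \delta \mid \nu \mid \langle\nu\rangle\tau$ ($\delta$ data types, $\nu$ name types). Disjoint countably infinite sets of variables and name-symbols $\mathsf a,\mathsf b,\dots$. A signature with constants, function and relation symbols always including swapping $(a\ b)\cdot t$, abstraction $\langle a\rangle t$, equality $t\approx u$, freshness $a\mathrel{\#}t$. Formulas: $\top,\bot$, atoms $p(\vec t)$, $\wedge,\vee,\supset,\forall,\exists$ and the fresh-name quantifier $\mathsf N\mathsf a{:}\nu.\phi$. Contexts $\Sigma ::= \cdot \mid \Sigma,x{:}\tau \mid \Sigma\#\mathsf a{:}\nu$; $|\cdot|=\emptyset$, $|\Sigma,x{:}\tau|=|\Sigma|$, $|\Sigma\#\mathsf a{:}\nu|=|\Sigma|\cup\{\mathsf a\mathrel{\#}t\mid t\text{ well-typed in }\Sigma\}$. Sequents $\Sigma;\Gamma\Rightarrow\Delta$. Rules of $NL^{\Rightarrow}$ (cut is not among them). Logical rules: hyp ($\Sigma;\Gamma,p(\vec t)\Rightarrow p(\vec t),\Delta$, atomic), $\top R$, $\bot L$ ($\Sigma;\Gamma,\bot\Rightarrow\Delta$), the classical G3c left/right rules for $\wedge,\vee,\supset,\forall,\exists$, $\mathsf N R$ (from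 $\Sigma\#\mathsf a{:}\nu;\Gamma\Rightarrow\phi,\Delta$, $\mathsf a\notin\Sigma$, infer $\Sigma;\Gamma\Rightarrow\mathsf N\mathsf a{:}\nu.\phi,\Delta$) and $\mathsf N L$ (from $\Sigma\#\mathsf a{:}\nu;\Gamma,\phi\Rightarrow\Delta$ infer $\Sigma;\Gamma,\mathsf N\mathsf a{:}\nu.\phi\Rightarrow\Delta$). Nonlogical rules: $\approx R$ (from $\Sigma;\Gamma,t\approx t\Rightarrow\Delta$ infer $\Sigma;\Gamma\Rightarrow\Delta$), $\approx S$ (from $\Gamma,t\approx u,P(t),P(u)\Rightarrow\Delta$ infer $\Gamma,t\approx u,P(t)\Rightarrow\Delta$), Ax (for each instance $\bigwedge\vec P\supset Q_1\vee\dots\vee Q_m$ of (S1) $(a\ a)\cdot x\approx x$, (S2) $(a\ b)\cdot(a\ b)\cdot x\approx x$, (S3) $(a\ b)\cdot a\approx b$, (E1) $(a\ b)\cdot c\approx c$, (E2) $(a\ b)\cdot f(\vec t)\approx f((a\ b)\cdot\vec t)$, (E3) $p(\vec t)\supset p((a\ b)\cdot\vec t)$, (F1) $a\mathrel{\#}x\wedge b\mathrel{\#}x\supset(a\ b)\cdot x\approx x$, (F2) $a\mathrel{\#}b$ for distinct name types, (F3) $a\mathrel{\#}a\supset\bot$ (zero premises), (F4) $a\mathrel{\#}b\vee a\approx b$, (A1) $a\mathrel{\#}y\wedge x\approx(a\ b)\cdot y\supset\langle a\rangle x\approx\langle b\rangle y$: from $\Sigma;\Gamma,\vec P,Q_i\Rightarrow\Delta$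 for all $i$ infer $\Sigma;\Gamma,\vec P\Rightarrow\Delta$), $A_2$ (from $\Gamma,\langle a\rangle t\approx\langle b\rangle u,a\approx b,t\approx u\Rightarrow\Delta$ and $\Gamma,\langle a\rangle t\approx\langle b\rangle u,a\mathrel{\#}u,t\approx(a\ b)\cdot u\Rightarrow\Delta$ infer $\Gamma,\langle a\rangle t\approx\langle b\rangle u\Rightarrow\Delta$), $A_3$ (from $\Sigma\vdash t:\langle\nu\rangle\sigma$ and $\Sigma,a{:}\nu,x{:}\sigma;\Gamma,t\approx\langle a\rangle x\Rightarrow\Delta$ infer $\Sigma;\Gamma\Rightarrow\Delta$), $F$ (from $\Sigma\#\mathsf a{:}\nu;\Gamma\Rightarrow\Delta$, $\mathsf a\notin\Sigma$, infer $\Sigma;\Gamma\Rightarrow\Delta$), $\Sigma\#$ (from $\Sigma;\Gamma,\mathsf a\mathrel{\#}t\Rightarrow\Delta$, $\mathsf a\mathrel{\#}t\in|\Sigma|$, infer $\Sigma;\Gamma\Rightarrow\Delta$). -}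

module Defs where

-- Contexts Σ are de Bruijn (head = most recent entry);
-- variables x:τ and name-symbols a:ν are the two kinds of context entries.

open import Data.List using (List; []; _∷_; _++_; map)
open import Data.List.Membership.Propositional using (_∈_)
open import Data.List.Relation.Unary.Any using (here; there)
open import Data.List.Relation.Unary.All using (All)
open import Data.List.Relation.Binary.Permutation.Propositional using (_↭_)
open import Relation.Binary.PropositionalEquality using (_≡_; _≢_; refl)
open import Data.Product using (_×_)
open import Data.Empty using (⊥)

-- Types τ ::= δ | ν | ⟨ν⟩τ
data Ty (D N : Set) : Set where
  dty : D → Ty D N
  nty : N → Ty D N
  aty : N → Ty D N → Ty D N

-- A signature: data types, name types, typed constants, function and relation
-- symbols (swapping, abstraction, ≈ and # are built into the syntax below).
record Sig : Set₁ where
  field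
    DTy   : Set
    NTy   : Set
    Const : Ty DTy NTy → Set
    Fun   : List (Ty DTy NTy) → Ty DTy NTy → Set
    Rel   : List (Ty DTy NTy) → Set

module NL (S : Sig) where
  open Sig S

  Type : Set
  Type = Ty DTy NTy

  data Entry : Set where
    var : Type → Entry
    nm  : NTy → Entry

  Ctx : Set
  Ctx = List Entry

  ety : Entry → Type
  ety (var τ) = τ
  ety (nm ν)  = nty ν

  data Tm (Σ : Ctx) : Type → Set
  data Tms (Σ : Ctx) : List Type → Set

  data Tm Σ where
    v   : ∀ {e} → e ∈ Σ → Tm Σ (ety e)
    con : ∀ {τ} → Const τ → Tm Σ τ
    app : ∀ {τs τ} → Fun τs τ → Tms Σ τs → Tm Σ τ
    sw  : ∀ {ν τ} → Tm Σ (nty ν) → Tm Σ (nty ν) → Tm Σ τ → Tm Σ τ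
    ab  : ∀ {ν τ} → Tm Σ (nty ν) → Tm Σ τ → Tm Σ (aty ν τ)

  data Tms Σ where
    []  : Tms Σ []
    _∷_ : ∀ {τ τs} → Tm Σ τ → Tms Σ τs → Tms Σ (τ ∷ τs)

  data Fm (Σ : Ctx) : Set where
    top bot : Fm Σ
    rel  : ∀ {τs} → Rel τs → Tms Σ τs → Fm Σ
    eq   : ∀ {τ} → Tm Σ τ → Tm Σ τ → Fm Σ
    frsh : ∀ {ν τ} → Tm Σ (nty ν) → Tm Σ τ → Fm Σ
    and or imp : Fm Σ → Fm Σ → Fm Σ
    all ex : (τ : Type) → Fm (var τ ∷ Σ) → Fm Σ
    new  : (ν : NTy) → Fm (nm ν ∷ Σ) → Fm Σ

  Ren : Ctx → Ctx → Set
  Ren Σ Σ' = ∀ {e} → e ∈ Σ → e ∈ Σ'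

  liftR : ∀ {Σ Σ' e} → Ren Σ Σ' → Ren (e ∷ Σ) (e ∷ Σ')
  liftR ρ (here p)  = here p
  liftR ρ (there p) = there (ρ p)

  renT  : ∀ {Σ Σ' τ} → Ren Σ Σ' → Tm Σ τ → Tm Σ' τ
  renTs : ∀ {Σ Σ' τs} → Ren Σ Σ' → Tms Σ τs → Tms Σ' τs
  renT ρ (v p) = v (ρ p)
  renT ρ (con c) = con c
  renT ρ (app f ts) = app f (renTs ρ ts)
  renT ρ (sw a b t) = sw (renT ρ a) (renT ρ b) (renT ρ t)
  renT ρ (ab a t) = ab (renT ρ a) (renT ρ t)
  renTs ρ [] = []
  renTs ρ (t ∷ ts) = renT ρ t ∷ renTs ρ ts

  renF : ∀ {Σ Σ'} → Ren Σ Σ' → Fm Σ → Fm Σ'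
  renF ρ top = top
  renF ρ bot = bot
  renF ρ (rel p ts) = rel p (renTs ρ ts)
  renF ρ (eq t u) = eq (renT ρ t) (renT ρ u)
  renF ρ (frsh a t) = frsh (renT ρ a) (renT ρ t)
  renF ρ (and A B) = and (renF ρ A) (renF ρ B)
  renF ρ (or A B) = or (renF ρ A) (renF ρ B)
  renF ρ (imp A B) = imp (renF ρ A) (renF ρ B)
  renF ρ (all τ A) = all τ (renF (liftR ρ) A)
  renF ρ (ex τ A) = ex τ (renF (liftR ρ) A)
  renF ρ (new ν A) = new ν (renF (liftR ρ) A)

  wkT : ∀ {Σ e τ} → Tm Σ τ → Tm (e ∷ Σ) τ
  wkT = renT there

  wkF : ∀ {Σ e} → Fm Σ → Fm (e ∷ Σ)
  wkF = renF there

  wkL : ∀ {Σ e} → List (Fm Σ) → List (Fm (e ∷ Σ))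
  wkL = map wkF

  Sub : Ctx → Ctx → Set
  Sub Σ Σ' = ∀ {e} → e ∈ Σ → Tm Σ' (ety e)

  liftS : ∀ {Σ Σ' e} → Sub Σ Σ' → Sub (e ∷ Σ) (e ∷ Σ')
  liftS σ (here refl) = v (here refl)
  liftS σ (there p)   = wkT (σ p)

  subT  : ∀ {Σ Σ' τ} → Sub Σ Σ' → Tm Σ τ → Tm Σ' τ
  subTs : ∀ {Σ Σ' τs} → Sub Σ Σ' → Tms Σ τs → Tms Σ' τs
  subT σ (v p) = σ p
  subT σ (con c) = con c
  subT σ (app f ts) = app f (subTs σ ts)
  subT σ (sw a b t) = sw (subT σ a) (subT σ b) (subT σ t)
  subT σ (ab a t) = ab (subT σ a) (subT σ t)
  subTs σ [] = []
  subTs σ (t ∷ ts) = subT σ t ∷ subTs σ ts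

  subF : ∀ {Σ Σ'} → Sub Σ Σ' → Fm Σ → Fm Σ'
  subF σ top = top
  subF σ bot = bot
  subF σ (rel p ts) = rel p (subTs σ ts)
  subF σ (eq t u) = eq (subT σ t) (subT σ u)
  subF σ (frsh a t) = frsh (subT σ a) (subT σ t)
  subF σ (and A B) = and (subF σ A) (subF σ B)
  subF σ (or A B) = or (subF σ A) (subF σ B)
  subF σ (imp A B) = imp (subF σ A) (subF σ B)
  subF σ (all τ A) = all τ (subF (liftS σ) A)
  subF σ (ex τ A) = ex τ (subF (liftS σ) A)
  subF σ (new ν A) = new ν (subF (liftS σ) A)

  sub0 : ∀ {Σ e} → Tm Σ (ety e) → Sub (e ∷ Σ) Σ
  sub0 t (here refl) = t
  sub0 t (there p)   = v p

  inst : ∀ {Σ e} → Fm (e ∷ Σ) → Tm Σ (ety e) → Fm Σ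
  inst A t = subF (sub0 t) A

  swTs : ∀ {Σ ν τs} → Tm Σ (nty ν) → Tm Σ (nty ν) → Tms Σ τs → Tms Σ τs
  swTs a b [] = []
  swTs a b (t ∷ ts) = sw a b t ∷ swTs a b ts

  data Atomic {Σ : Ctx} : Fm Σ → Set where
    at-rel : ∀ {τs} {p : Rel τs} {ts : Tms Σ τs} → Atomic (rel p ts)
    at-eq  : ∀ {τ} {t u : Tm Σ τ} → Atomic (eq t u)
    at-fr  : ∀ {ν τ} {a : Tm Σ (nty ν)} {t : Tm Σ τ} → Atomic (frsh a t)

  data Constraint {Σ : Ctx} : Fm Σ → Set where
    c-eq : ∀ {τ} {t u : Tm Σ τ} → Constraint (eq t u)
    c-fr : ∀ {ν τ} {a : Tm Σ (nty ν)} {t : Tm Σ τ} → Constraint (frsh a t)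

  ConstraintSet : ∀ {Σ} → List (Fm Σ) → Set
  ConstraintSet = All Constraint

  data FreshFact : (Σ : Ctx) → Fm Σ → Set where
    fnew  : ∀ {Σ ν τ} (t : Tm Σ τ) →
            FreshFact (nm ν ∷ Σ) (frsh (v (here refl)) (wkT t))
    fskip : ∀ {Σ e φ} → FreshFact Σ φ → FreshFact (e ∷ Σ) (wkF φ)

  -- instances ⋀P⃗ ⊃ Q₁ ∨ … ∨ Qₘ of the axioms:  AxInst Σ P⃗ Q⃗
  data AxInst (Σ : Ctx) : List (Fm Σ) → List (Fm Σ) → Set where
    S1   : ∀ {ν τ} (a : Tm Σ (nty ν)) (x : Tm Σ τ) →
           AxInst Σ [] (eq (sw a a x) x ∷ [])
    S2   : ∀ {ν τ} (a b : Tm Σ (nty ν)) (x : Tm Σ τ) →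
           AxInst Σ [] (eq (sw a b (sw a b x)) x ∷ [])
    S3   : ∀ {ν} (a b : Tm Σ (nty ν)) →
           AxInst Σ [] (eq (sw a b a) b ∷ [])
    E1   : ∀ {ν τ} (a b : Tm Σ (nty ν)) (c : Const τ) →
           AxInst Σ [] (eq (sw a b (con c)) (con c) ∷ [])
    -- E2 for user function symbols, for swapping and for abstraction
    E2f  : ∀ {ν τs τ} (a b : Tm Σ (nty ν)) (f : Fun τs τ) (ts : Tms Σ τs) →
           AxInst Σ [] (eq (sw a b (app f ts)) (app f (swTs a b ts)) ∷ [])
    E2sw : ∀ {ν ν' τ} (a b : Tm Σ (nty ν)) (c d : Tm Σ (nty ν')) (t : Tm Σ τ) →
           AxInst Σ [] (eq (sw a b (sw c d t)) (sw (sw a b c) (sw a b d) (sw a b t)) ∷ [])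
    E2ab : ∀ {ν ν' τ} (a b : Tm Σ (nty ν)) (c : Tm Σ (nty ν')) (t : Tm Σ τ) →
           AxInst Σ [] (eq (sw a b (ab c t)) (ab (sw a b c) (sw a b t)) ∷ [])
    -- E3 for user relation symbols, for ≈ and for #
    E3r  : ∀ {ν τs} (a b : Tm Σ (nty ν)) (p : Rel τs) (ts : Tms Σ τs) →
           AxInst Σ (rel p ts ∷ []) (rel p (swTs a b ts) ∷ [])
    E3eq : ∀ {ν τ} (a b : Tm Σ (nty ν)) (t u : Tm Σ τ) →
           AxInst Σ (eq t u ∷ []) (eq (sw a b t) (sw a b u) ∷ [])
    E3fr : ∀ {ν ν' τ} (a b : Tm Σ (nty ν)) (c : Tm Σ (nty ν')) (t : Tm Σ τ) →
           AxInst Σ (frsh c t ∷ []) (frsh (sw a b c) (sw a b t) ∷ [])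
    F1   : ∀ {ν τ} (a b : Tm Σ (nty ν)) (x : Tm Σ τ) →
           AxInst Σ (frsh a x ∷ frsh b x ∷ []) (eq (sw a b x) x ∷ [])
    F2   : ∀ {ν ν'} (a : Tm Σ (nty ν)) (b : Tm Σ (nty ν')) → ν ≢ ν' →
           AxInst Σ [] (frsh a b ∷ [])
    F3   : ∀ {ν} (a : Tm Σ (nty ν)) →
           AxInst Σ (frsh a a ∷ []) []
    F4   : ∀ {ν} (a b : Tm Σ (nty ν)) →
           AxInst Σ [] (frsh a b ∷ eq a b ∷ [])
    A1   : ∀ {ν τ} (a b : Tm Σ (nty ν)) (x y : Tm Σ τ) →
           AxInst Σ (frsh a y ∷ eq x (sw a b y) ∷ []) (eq (ab a x) (ab b y) ∷ [])

  -- cut-free derivations in NL⇒ ;  Γ, Δ are multisets (lists up to ↭)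
  data Der : (Σ : Ctx) → List (Fm Σ) → List (Fm Σ) → Set where
    hyp  : ∀ {Σ Γ Δ} {P : Fm Σ} → Atomic P → P ∈ Γ → P ∈ Δ → Der Σ Γ Δ
    topR : ∀ {Σ Γ Δ} → top ∈ Δ → Der Σ Γ Δ
    botL : ∀ {Σ Γ Δ} → bot ∈ Γ → Der Σ Γ Δ
    andL : ∀ {Σ Γ Γ₀ Δ} {A B : Fm Σ} → Γ ↭ and A B ∷ Γ₀ →
           Der Σ (A ∷ B ∷ Γ₀) Δ → Der Σ Γ Δ
    andR : ∀ {Σ Γ Δ Δ₀} {A B : Fm Σ} → Δ ↭ and A B ∷ Δ₀ →
           Der Σ Γ (A ∷ Δ₀) → Der Σ Γ (B ∷ Δ₀) → Der Σ Γ Δ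
    orL  : ∀ {Σ Γ Γ₀ Δ} {A B : Fm Σ} → Γ ↭ or A B ∷ Γ₀ →
           Der Σ (A ∷ Γ₀) Δ → Der Σ (B ∷ Γ₀) Δ → Der Σ Γ Δ
    orR  : ∀ {Σ Γ Δ Δ₀} {A B : Fm Σ} → Δ ↭ or A B ∷ Δ₀ →
           Der Σ Γ (A ∷ B ∷ Δ₀) → Der Σ Γ Δ
    impL : ∀ {Σ Γ Γ₀ Δ} {A B : Fm Σ} → Γ ↭ imp A B ∷ Γ₀ →
           Der Σ Γ₀ (A ∷ Δ) → Der Σ (B ∷ Γ₀) Δ → Der Σ Γ Δ
    impR : ∀ {Σ Γ Δ Δ₀} {A B : Fm Σ} → Δ ↭ imp A B ∷ Δ₀ →
           Der Σ (A ∷ Γ) (B ∷ Δ₀) → Der Σ Γ Δ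
    allL : ∀ {Σ Γ Δ τ} {A : Fm (var τ ∷ Σ)} → all τ A ∈ Γ → (t : Tm Σ τ) →
           Der Σ (inst A t ∷ Γ) Δ → Der Σ Γ Δ
    allR : ∀ {Σ Γ Δ Δ₀ τ} {A : Fm (var τ ∷ Σ)} → Δ ↭ all τ A ∷ Δ₀ →
           Der (var τ ∷ Σ) (wkL Γ) (A ∷ wkL Δ₀) → Der Σ Γ Δ
    exL  : ∀ {Σ Γ Γ₀ Δ τ} {A : Fm (var τ ∷ Σ)} → Γ ↭ ex τ A ∷ Γ₀ →
           Der (var τ ∷ Σ) (A ∷ wkL Γ₀) (wkL Δ) → Der Σ Γ Δ
    exR  : ∀ {Σ Γ Δ τ} {A : Fm (var τ ∷ Σ)} → ex τ A ∈ Δ → (t : Tm Σ τ) →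
           Der Σ Γ (inst A t ∷ Δ) → Der Σ Γ Δ
    newR : ∀ {Σ Γ Δ Δ₀ ν} {A : Fm (nm ν ∷ Σ)} → Δ ↭ new ν A ∷ Δ₀ →
           Der (nm ν ∷ Σ) (wkL Γ) (A ∷ wkL Δ₀) → Der Σ Γ Δ
    newL : ∀ {Σ Γ Γ₀ Δ ν} {A : Fm (nm ν ∷ Σ)} → Γ ↭ new ν A ∷ Γ₀ →
           Der (nm ν ∷ Σ) (A ∷ wkL Γ₀) (wkL Δ) → Der Σ Γ Δ
    eqR  : ∀ {Σ Γ Δ τ} (t : Tm Σ τ) → Der Σ (eq t t ∷ Γ) Δ → Der Σ Γ Δ
    eqS  : ∀ {Σ Γ Γ₀ Δ τ} (P : Fm (var τ ∷ Σ)) → Atomic P → (t u : Tm Σ τ) →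
           Γ ↭ eq t u ∷ inst P t ∷ Γ₀ →
           Der Σ (inst P u ∷ Γ) Δ → Der Σ Γ Δ
    ax   : ∀ {Σ Γ Γ₀ Δ Ps Qs} → AxInst Σ Ps Qs → Γ ↭ Ps ++ Γ₀ →
           (∀ {Q} → Q ∈ Qs → Der Σ (Q ∷ Γ) Δ) → Der Σ Γ Δ
    A2   : ∀ {Σ Γ Δ ν τ} {a b : Tm Σ (nty ν)} {t u : Tm Σ τ} →
           eq (ab a t) (ab b u) ∈ Γ →
           Der Σ (eq a b ∷ eq t u ∷ Γ) Δ →
           Der Σ (frsh a u ∷ eq t (sw a b u) ∷ Γ) Δ → Der Σ Γ Δ
    A3   : ∀ {Σ Γ Δ ν σ} (t : Tm Σ (aty ν σ)) →
           Der (var σ ∷ var (nty ν) ∷ Σ)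
               (eq (wkT (wkT t)) (ab (v (there (here refl))) (v (here refl))) ∷ wkL (wkL Γ))
               (wkL (wkL Δ)) →
           Der Σ Γ Δ
    F    : ∀ {Σ Γ Δ ν} → Der (nm ν ∷ Σ) (wkL Γ) (wkL Δ) → Der Σ Γ Δ
    Σ#   : ∀ {Σ Γ Δ} {φ : Fm Σ} → FreshFact Σ φ →
           Der Σ (φ ∷ Γ) Δ → Der Σ Γ Δ

  Node : ∀ {Σ} → List (Fm Σ) → List (Fm Σ) → Set
  Node Γ Δ = ConstraintSet Γ × (Δ ≡ bot ∷ [])

  NonlogicalConstraint : ∀ {Σ Γ Δ} → Der Σ Γ Δ → Set
  NonlogicalConstraint {Γ = Γ} {Δ} (eqR t d) = Node Γ Δ × NonlogicalConstraint d
  NonlogicalConstraint {Γ = Γ} {Δ} (eqS P at t u p d) = Node Γ Δ × NonlogicalConstraint d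
  NonlogicalConstraint {Γ = Γ} {Δ} (ax {Qs = Qs} i p k) =
    Node Γ Δ × (∀ {Q} (q : Q ∈ Qs) → NonlogicalConstraint (k q))
  NonlogicalConstraint {Γ = Γ} {Δ} (A2 m d₁ d₂) =
    Node Γ Δ × NonlogicalConstraint d₁ × NonlogicalConstraint d₂
  NonlogicalConstraint {Γ = Γ} {Δ} (A3 t d) = Node Γ Δ × NonlogicalConstraint d
  NonlogicalConstraint {Γ = Γ} {Δ} (F d) = Node Γ Δ × NonlogicalConstraint d
  NonlogicalConstraint {Γ = Γ} {Δ} (Σ# f d) = Node Γ Δ × NonlogicalConstraint d
  NonlogicalConstraint _ = ⊥

  EmptyBot : Set
  EmptyBot = Der [] [] (bot ∷ [])

-- Each logical rule
-- needs a compound principal formula (or an atom, ⊤ or ⊥ for the axioms) in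
-- the antecedent or the succedent; but the succedent is just ⊥ and the
-- antecedent only contains constraints.  Every nonlogical rule keeps ⊥ as the
-- succedent and adds only constraints to the antecedent, because the two rules
-- that could introduce a user relation atom (E3 and ≈S) need one already.
module Submission where

open import Defs
open import Data.Product using (Σ; _,_)
open import Data.List using (List; []; _∷_)
open import Data.List.Membership.Propositional using (_∈_)
open import Data.List.Relation.Unary.Any using (here; there)
open import Data.List.Relation.Unary.All using ([]; _∷_; head; tail; lookup)
open import Data.List.Relation.Unary.All.Properties using (++⁻ˡ)
open import Data.List.Relation.Binary.Permutation.Propositional using (_↭_; ↭-sym)
open import Data.List.Relation.Binary.Permutation.Propositional.Properties
  using (All-resp-↭; ↭-singleton-inv)
open import Relation.Binary.PropositionalEquality using (_≡_; refl)

module ConstraintDerivations (S : Sig) where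
  open NL S

  wkF-constraint : ∀ {Ξ e} {φ : Fm Ξ} → Constraint φ → Constraint (wkF {e = e} φ)
  wkF-constraint c-eq = c-eq
  wkF-constraint c-fr = c-fr

  wkL-constraintSet : ∀ {Ξ e} {Γ : List (Fm Ξ)} →
    ConstraintSet Γ → ConstraintSet (wkL {e = e} Γ)
  wkL-constraintSet []       = []
  wkL-constraintSet (c ∷ cs) = wkF-constraint c ∷ wkL-constraintSet cs

  inst-atomic-constraint : ∀ {Ξ τ} {P : Fm (var τ ∷ Ξ)} → Atomic P → (t u : Tm Ξ τ) →
    Constraint (inst P t) → Constraint (inst P u)
  inst-atomic-constraint at-rel t u ()
  inst-atomic-constraint at-eq  t u _ = c-eq
  inst-atomic-constraint at-fr  t u _ = c-fr

  freshFact-constraint : ∀ {Ξ φ} → FreshFact Ξ φ → Constraint φ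
  freshFact-constraint (fnew t)  = c-fr
  freshFact-constraint (fskip f) = wkF-constraint (freshFact-constraint f)

  axInst-constraintSet : ∀ {Ξ Ps Qs} → AxInst Ξ Ps Qs →
    ConstraintSet Ps → ConstraintSet Qs
  axInst-constraintSet (S1 a x)           _        = c-eq ∷ []
  axInst-constraintSet (S2 a b x)         _        = c-eq ∷ []
  axInst-constraintSet (S3 a b)           _        = c-eq ∷ []
  axInst-constraintSet (E1 a b c)         _        = c-eq ∷ []
  axInst-constraintSet (E2f a b f ts)     _        = c-eq ∷ []
  axInst-constraintSet (E2sw a b c d t)   _        = c-eq ∷ []
  axInst-constraintSet (E2ab a b c t)     _        = c-eq ∷ []
  axInst-constraintSet (E3r a b p ts)     (() ∷ _)
  axInst-constraintSet (E3eq a b t u)     _        = c-eq ∷ []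
  axInst-constraintSet (E3fr a b c t)     _        = c-fr ∷ []
  axInst-constraintSet (F1 a b x)         _        = c-eq ∷ []
  axInst-constraintSet (F2 a b ν≢ν')      _        = c-fr ∷ []
  axInst-constraintSet (F3 a)             _        = []
  axInst-constraintSet (F4 a b)           _        = c-fr ∷ c-eq ∷ []
  axInst-constraintSet (A1 a b x y)       _        = c-eq ∷ []

  principal-constraint : ∀ {Ξ} {Γ Γ₀ : List (Fm Ξ)} {φ} →
    Γ ↭ φ ∷ Γ₀ → ConstraintSet Γ → Constraint φ
  principal-constraint p cs = head (All-resp-↭ p cs)

  principal-bot : ∀ {Ξ} {Δ₀ : List (Fm Ξ)} {φ} →
    bot ∷ [] ↭ φ ∷ Δ₀ → φ ∷ Δ₀ ≡ bot ∷ []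
  principal-bot p = ↭-singleton-inv (↭-sym p)

  derivation-nonlogicalConstraint : ∀ {Ξ Γ} (d : Der Ξ Γ (bot ∷ [])) →
    ConstraintSet Γ → NonlogicalConstraint d
  derivation-nonlogicalConstraint (hyp () _ (here refl)) cs
  derivation-nonlogicalConstraint (hyp _ _ (there ())) cs
  derivation-nonlogicalConstraint (topR (here ())) cs
  derivation-nonlogicalConstraint (topR (there ())) cs
  derivation-nonlogicalConstraint (botL p) cs with () ← lookup cs p
  derivation-nonlogicalConstraint (andL p _) cs with () ← principal-constraint p cs
  derivation-nonlogicalConstraint (andR p _ _) cs with () ← principal-bot p
  derivation-nonlogicalConstraint (orL p _ _) cs with () ← principal-constraint p cs
  derivation-nonlogicalConstraint (orR p _) cs with () ← principal-bot p
  derivation-nonlogicalConstraint (impL p _ _) cs with () ← principal-constraint p cs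
  derivation-nonlogicalConstraint (impR p _) cs with () ← principal-bot p
  derivation-nonlogicalConstraint (allL p _ _) cs with () ← lookup cs p
  derivation-nonlogicalConstraint (allR p _) cs with () ← principal-bot p
  derivation-nonlogicalConstraint (exL p _) cs with () ← principal-constraint p cs
  derivation-nonlogicalConstraint (exR (here ()) _ _) cs
  derivation-nonlogicalConstraint (exR (there ()) _ _) cs
  derivation-nonlogicalConstraint (newR p _) cs with () ← principal-bot p
  derivation-nonlogicalConstraint (newL p _) cs with () ← principal-constraint p cs
  derivation-nonlogicalConstraint (eqR t d) cs =
    (cs , refl) , derivation-nonlogicalConstraint d (c-eq ∷ cs)
  derivation-nonlogicalConstraint (eqS P a t u p d) cs =
    (cs , refl) , derivation-nonlogicalConstraint d (Pu ∷ cs)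
    where Pu = inst-atomic-constraint a t u (head (tail (All-resp-↭ p cs)))
  derivation-nonlogicalConstraint (ax {Ps = Ps} i p k) cs =
    (cs , refl) , λ q → derivation-nonlogicalConstraint (k q) (lookup Qs q ∷ cs)
    where Qs = axInst-constraintSet i (++⁻ˡ Ps (All-resp-↭ p cs))
  derivation-nonlogicalConstraint (A2 _ d₁ d₂) cs =
    (cs , refl) , derivation-nonlogicalConstraint d₁ (c-eq ∷ c-eq ∷ cs)
                , derivation-nonlogicalConstraint d₂ (c-fr ∷ c-eq ∷ cs)
  derivation-nonlogicalConstraint (A3 t d) cs =
    (cs , refl) , derivation-nonlogicalConstraint d
                    (c-eq ∷ wkL-constraintSet (wkL-constraintSet cs))
  derivation-nonlogicalConstraint (F d) cs =
    (cs , refl) , derivation-nonlogicalConstraint d (wkL-constraintSet cs)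
  derivation-nonlogicalConstraint (Σ# f d) cs =
    (cs , refl) , derivation-nonlogicalConstraint d (freshFact-constraint f ∷ cs)

mainTheorem5 : (S : Sig) → NL.EmptyBot S →
    Σ (NL.EmptyBot S) (NL.NonlogicalConstraint S)
mainTheorem5 S d = d , derivation-nonlogicalConstraint d []
  where open ConstraintDerivations S
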